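{- Let $L$ be a finite lattice with associated neighbourhood frame $\mathbb{F}_L = (J(L),\sigma_{\mathcal{M}})$. Then for all lattice terms $t$ and $s$ over $\mathsf{AtProp}$, $$ L \models t \leq s \quad\text{iff}\quad \mathbb{F}_L \Vdash ST(t) \leq ST(s),$$ where $L \models t \leq s$ means $v(t) \leq v(s)$ for every assignment $v : \mathsf{AtProp} \to L$, and $\mathbb{F}_L \Vdash ST(t) \leq ST(s)$ means that for every closed valuation $u$ and every $j \in J(L)$, if $\mathbb{F}_L, u, j \Vdash ST(t)$ then $\mathbb{F}_L, u, j \Vdash ST(s)$.
   Context: For a finite lattice $L$, $J(L)$ is its set of join-irreducible elements ordered as in $L$. For $A,B \subseteq L$, $A \ll B$ means every element of $A$ lies below some element of $B$. A minimal join-cover of $a \in L$ is a $\leq$-antichain $C \subseteq L$ with $a \leq \bigvee C$ such that for every $\leq$-antichain $D$ with $a \leq \bigvee D$ and $D \ll C$ we have $D = C$; let $\mathcal{M}(j)$ be the set of minimal join-covers of $j \in J(L)$ (these are subsets of $J(L)$). The neighbourhood frame associated with $L$ is $\mathbb{F}_L = (J(L),\sigma_{\mathcal{M}})$ with $\sigma_{\mathcal{M}}(j) := \{S \subseteq J(L) \mid C \subseteq S \text{ for some } C \in \mathcal{M}(j)\}$. A downset $S$ of $(J(L),\leq)$ is closed if $S = \{x \in J(L) \mid D \subseteq S \text{ for some } D \in \mathcal{M}(x)\}$; a closed valuation is a map assigning to each propositional variable in $\mathsf{AtProp}$ a closed downset of $(J(L),\leq)$. Lattice terms are built by $t ::=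 \bot \mid \top \mid p \mid t \vee t \mid t \wedge t$ with $p \in \mathsf{AtProp}$. The standard translation $ST$ into monotone modal formulas is defined by $ST(p) = p$, $ST(\top)=\top$, $ST(\bot)=\bot$, $ST(t \wedge s) = ST(t) \wedge ST(s)$, $ST(t \vee s) = (\exists\forall)(ST(t) \vee ST(s))$. For a neighbourhood frame $(X,\sigma)$, a valuation $u$ and $w \in X$: $w \Vdash \top$ always, $w \Vdash \bot$ never, $w \Vdash p$ iff $w \in u(p)$, $\wedge$ and $\vee$ are interpreted classically, and $w \Vdash (\exists\forall)\varphi$ iff there is some $C \in \sigma(w)$ such that every $c \in C$ satisfies $c \Vdash \varphi$. -}

module Defs where

open import Level using (0ℓ)
open import Data.Nat using (ℕ)
open import Data.Fin using (Fin)
open import Data.Fin.Subset using (Subset; _∈_; _⊆_)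
open import Data.Vec using (lookup)
open import Data.List using (List; foldr; allFin)
open import Data.Bool using (if_then_else_)
open import Data.Product using (Σ; ∃; _×_)
open import Data.Sum using (_⊎_)
open import Data.Empty using (⊥)
open import Data.Unit using (⊤)
open import Relation.Nullary using (¬_)
open import Relation.Binary.Core using (Rel)
open import Relation.Binary.PropositionalEquality using (_≡_)
open import Relation.Binary.Lattice.Structures using (IsBoundedLattice)
open import Algebra.Core using (Op₂)
open import Function.Bundles using (_⇔_)

-- A finite lattice: a (bounded) lattice whose carrier is Fin n.
-- Every finite (nonempty) lattice is isomorphic to one of this form,
-- and finite nonempty lattices are automatically bounded.

record FiniteLattice : Set₁ where
  field
    n   : ℕ
    _≤_ : Rel (Fin n) 0ℓ
    _∨_ : Op₂ (Fin n)
    _∧_ : Op₂ (Fin n)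
    top : Fin n
    bot : Fin n
    isBoundedLattice : IsBoundedLattice _≡_ _≤_ _∨_ _∧_ top bot

data Term (AtProp : Set) : Set where
  ⊥ₜ   : Term AtProp
  ⊤ₜ   : Term AtProp
  var  : AtProp → Term AtProp
  _∨ₜ_ : Term AtProp → Term AtProp → Term AtProp
  _∧ₜ_ : Term AtProp → Term AtProp → Term AtProp

data Fm (AtProp : Set) : Set where
  ⊥ₘ   : Fm AtProp
  ⊤ₘ   : Fm AtProp
  var  : AtProp → Fm AtProp
  _∨ₘ_ : Fm AtProp → Fm AtProp → Fm AtProp
  _∧ₘ_ : Fm AtProp → Fm AtProp → Fm AtProp
  ∃∀   : Fm AtProp → Fm AtProp

ST : {AtProp : Set} → Term AtProp → Fm AtProp
ST ⊥ₜ = ⊥ₘ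
ST ⊤ₜ = ⊤ₘ
ST (var p) = var p
ST (t ∧ₜ s) = ST t ∧ₘ ST s
ST (t ∨ₜ s) = ∃∀ (ST t ∨ₘ ST s)

module _ (L : FiniteLattice) where
  open FiniteLattice L

  ⋁ : Subset n → Fin n
  ⋁ C = foldr (λ i acc → if lookup C i then i ∨ acc else acc) bot (allFin n)

  IsJI : Fin n → Set
  IsJI j = ¬ (j ≡ bot) × (∀ a b → j ≡ a ∨ b → (j ≡ a) ⊎ (j ≡ b))

  SubsetOfJ : Subset n → Set
  SubsetOfJ S = ∀ x → x ∈ S → IsJI x

  Antichain : Subset n → Set
  Antichain C = ∀ x y → x ∈ C → y ∈ C → x ≤ y → x ≡ y

  _≪_ : Subset n → Subset n → Set
  A ≪ B = ∀ a → a ∈ A → Σ (Fin n) (λ b → b ∈ B × a ≤ b)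

  IsMinJoinCover : Fin n → Subset n → Set
  IsMinJoinCover a C =
    Antichain C × a ≤ ⋁ C ×
    (∀ D → Antichain D → a ≤ ⋁ D → D ≪ C → D ≡ C)

  σM : Fin n → Subset n → Set
  σM j S = SubsetOfJ S × Σ (Subset n) (λ C → IsMinJoinCover j C × C ⊆ S)

  IsDownsetJ : Subset n → Set
  IsDownsetJ S = SubsetOfJ S ×
    (∀ x y → IsJI x → IsJI y → x ≤ y → y ∈ S → x ∈ S)

  IsClosedDownset : Subset n → Set
  IsClosedDownset S = IsDownsetJ S ×
    (∀ x → IsJI x →
      (x ∈ S ⇔ Σ (Subset n) (λ D → IsMinJoinCover x D × D ⊆ S)))

  ⟦_⟧ : {AtProp : Set} → Term AtProp → (AtProp → Fin n) → Fin n
  ⟦ ⊥ₜ ⟧ v = bot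
  ⟦ ⊤ₜ ⟧ v = top
  ⟦ var p ⟧ v = v p
  ⟦ t ∨ₜ s ⟧ v = ⟦ t ⟧ v ∨ ⟦ s ⟧ v
  ⟦ t ∧ₜ s ⟧ v = ⟦ t ⟧ v ∧ ⟦ s ⟧ v

  Valid≤ : {AtProp : Set} → Term AtProp → Term AtProp → Set
  Valid≤ {AtProp} t s = (v : AtProp → Fin n) → ⟦ t ⟧ v ≤ ⟦ s ⟧ v

  Forces : {AtProp : Set} → (AtProp → Subset n) → Fin n → Fm AtProp → Set
  Forces u w ⊥ₘ = ⊥
  Forces u w ⊤ₘ = ⊤
  Forces u w (var p) = w ∈ u p
  Forces u w (φ ∨ₘ ψ) = Forces u w φ ⊎ Forces u w ψ
  Forces u w (φ ∧ₘ ψ) = Forces u w φ × Forces u w ψ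
  Forces u w (∃∀ φ) =
    Σ (Subset n) (λ C → σM w C × (∀ c → c ∈ C → Forces u c φ))

  FrameValid≤ : {AtProp : Set} → Fm AtProp → Fm AtProp → Set
  FrameValid≤ {AtProp} φ ψ =
    (u : AtProp → Subset n) → (∀ p → IsClosedDownset (u p)) →
    ∀ j → IsJI j → Forces u j φ → Forces u j ψ

-- Every element a of a finite lattice is the join of the join-irreducibles below it, so an
-- assignment v is recovered from the closed valuation p ↦ J(L) ∩ ↓ v(p), and conversely a
-- closed downset S is recovered from its join ⋁ S: a join-irreducible x lies in S iff x ≤ ⋁ S.
-- Under this correspondence a join-irreducible x forces ST(t) iff x ≤ v(t). The only
-- non-trivial case is a join: x ≤ a ∨ b iff x has a minimal join-cover refining {a, b}, and
-- such covers exist by descent along the strictly shrinking downsets of antichain covers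
-- (finiteness) and consist of join-irreducibles (otherwise an element could be split or
-- dropped, contradicting minimality). Both directions of the theorem then follow by
-- comparing join-irreducibles.
module Submission where

open import Level using (0ℓ)
open import Data.Nat using (ℕ)
open import Data.Fin using (Fin)
open import Data.Fin.Properties using (any?; all?) renaming (_≟_ to _≟ᶠ_)
open import Data.Fin.Subset using (Subset; _∈_; _∉_; _⊆_; _⊂_; ⁅_⁆; _∪_) renaming (⊥ to ∅)
open import Data.Fin.Subset.Properties
  using (_∈?_; ⊆-antisym; ∉⊥; x∈⁅x⁆; x∈⁅y⁆⇒x≡y; x∈p∪q⁺; x∈p∪q⁻; anySubset?)
open import Data.Fin.Subset.Induction using (⊂-wellFounded)
open import Data.Vec using (lookup; tabulate)
open import Data.Vec.Properties using (lookup∘tabulate; []=⇒lookup; lookup⇒[]=)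
open import Data.List using (List; []; _∷_; foldr; allFin)
open import Data.List.Relation.Unary.Any using (here; there)
open import Data.List.Membership.Propositional using () renaming (_∈_ to _∈ˡ_)
open import Data.List.Membership.Propositional.Properties using (∈-allFin)
open import Data.Bool using (true; false; if_then_else_)
open import Data.Product using (∃; _×_; _,_; proj₁; proj₂)
open import Data.Sum using (_⊎_; inj₁; inj₂; [_,_]′)
open import Data.Empty using (⊥-elim)
open import Data.Unit using (tt)
open import Function.Base using (_on_)
open import Function.Bundles using (_⇔_; mk⇔; module Equivalence)
open import Induction.WellFounded using (Acc; acc)
import Relation.Binary.Construct.On as On
open import Relation.Nullary using (Dec; yes; no; does)
open import Relation.Nullary.Decidable
  using (dec-true; decidable-stable; _×-dec_; _⊎-dec_; _→-dec_; ¬?; map′)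
open import Relation.Unary using (Pred; Decidable)
open import Relation.Binary.PropositionalEquality using (_≡_; _≢_; refl; sym; trans; subst)
open import Relation.Binary.Lattice.Structures using (IsBoundedLattice)
open import Defs hiding (_≪_)
import Defs

open Equivalence using (to; from)

module _ {n : ℕ} {P : Pred (Fin n) 0ℓ} (P? : Decidable P) where

  toSubset : Subset n
  toSubset = tabulate (λ x → does (P? x))

  ∈-toSubset⁺ : ∀ {x} → P x → x ∈ toSubset
  ∈-toSubset⁺ {x} px =
    lookup⇒[]= x _ (trans (lookup∘tabulate (λ y → does (P? y)) x) (dec-true (P? x) px))

  ∈-toSubset⁻ : ∀ {x} → x ∈ toSubset → P x
  ∈-toSubset⁻ {x} x∈ with P? x | trans (sym (lookup∘tabulate (λ y → does (P? y)) x)) ([]=⇒lookup x∈)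
  ... | yes px | _ = px
  ... | no _   | ()

module _ (L : FiniteLattice) where
  open FiniteLattice L
  open IsBoundedLattice isBoundedLattice
    using (x≤x∨y; y≤x∨y; ∨-least; x∧y≤x; x∧y≤y; ∧-greatest; antisym; maximum; minimum)
    renaming (refl to ≤-refl; trans to ≤-trans)

  _≪_ : Subset n → Subset n → Set
  _≪_ = Defs._≪_ L

  _≤?_ : (x y : Fin n) → Dec (x ≤ y)
  x ≤? y = map′ (λ x∨y≡y → subst (x ≤_) x∨y≡y (x≤x∨y x y))
                (λ x≤y → antisym (∨-least x≤y ≤-refl) (y≤x∨y x y))
                (x ∨ y ≟ᶠ y)

  isJI? : Decidable (IsJI L)
  isJI? x = ¬? (x ≟ᶠ bot) ×-dec
            all? (λ a → all? (λ b → (x ≟ᶠ a ∨ b) →-dec ((x ≟ᶠ a) ⊎-dec (x ≟ᶠ b))))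

  antichain? : ∀ C → Dec (Antichain L C)
  antichain? C = all? (λ x → all? (λ y → (x ∈? C) →-dec (y ∈? C) →-dec (x ≤? y) →-dec (x ≟ᶠ y)))

  ≪? : ∀ A B → Dec (A ≪ B)
  ≪? A B = all? (λ a → (a ∈? A) →-dec any? (λ b → (b ∈? B) ×-dec (a ≤? b)))

  -- ⋁ L C unfolds to joinIn C (allFin n).
  joinIn : Subset n → List (Fin n) → Fin n
  joinIn C = foldr (λ i acc → if lookup C i then i ∨ acc else acc) bot

  ⋁-upperBound : ∀ {C x} → x ∈ C → x ≤ ⋁ L C
  ⋁-upperBound {C} {x} x∈C = go (allFin n) (∈-allFin x)
    where
    go : ∀ xs → x ∈ˡ xs → x ≤ joinIn C xs
    go (i ∷ xs) (here refl) with lookup C i | []=⇒lookup x∈C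
    ... | true  | _ = x≤x∨y i _
    ... | false | ()
    go (i ∷ xs) (there x∈xs) with lookup C i
    ... | true  = ≤-trans (go xs x∈xs) (y≤x∨y i _)
    ... | false = go xs x∈xs

  ⋁-least : ∀ {C b} → (∀ {x} → x ∈ C → x ≤ b) → ⋁ L C ≤ b
  ⋁-least {C} {b} bound = go (allFin n)
    where
    go : ∀ xs → joinIn C xs ≤ b
    go [] = minimum b
    go (i ∷ xs) with lookup C i in C[i]
    ... | true  = ∨-least (bound (lookup⇒[]= i C C[i])) (go xs)
    ... | false = go xs

  ⊆⇒≪ : ∀ {A B} → A ⊆ B → A ≪ B
  ⊆⇒≪ A⊆B a a∈A = a , A⊆B a∈A , ≤-refl

  ≪-refl : ∀ {A} → A ≪ A
  ≪-refl = ⊆⇒≪ (λ a∈A → a∈A)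

  ≪-trans : ∀ {A B C} → A ≪ B → B ≪ C → A ≪ C
  ≪-trans A≪B B≪C a a∈A =
    let (b , b∈B , a≤b) = A≪B a a∈A
        (c , c∈C , b≤c) = B≪C b b∈B
    in c , c∈C , ≤-trans a≤b b≤c

  ⋁-mono-≪ : ∀ {A B} → A ≪ B → ⋁ L A ≤ ⋁ L B
  ⋁-mono-≪ A≪B = ⋁-least λ {a} a∈A →
    let (b , b∈B , a≤b) = A≪B a a∈A in ≤-trans a≤b (⋁-upperBound b∈B)

  ⋁-mono-⊆ : ∀ {A B} → A ⊆ B → ⋁ L A ≤ ⋁ L B
  ⋁-mono-⊆ A⊆B = ⋁-mono-≪ (⊆⇒≪ A⊆B)

  pair : Fin n → Fin n → Subset n
  pair a b = ⁅ a ⁆ ∪ ⁅ b ⁆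

  ∈-pair⁻ : ∀ {a b z} → z ∈ pair a b → z ≡ a ⊎ z ≡ b
  ∈-pair⁻ {a} {b} z∈ with x∈p∪q⁻ ⁅ a ⁆ ⁅ b ⁆ z∈
  ... | inj₁ z∈a = inj₁ (x∈⁅y⁆⇒x≡y a z∈a)
  ... | inj₂ z∈b = inj₂ (x∈⁅y⁆⇒x≡y b z∈b)

  ∨≤⋁-pair : ∀ a b → (a ∨ b) ≤ ⋁ L (pair a b)
  ∨≤⋁-pair a b = ∨-least (⋁-upperBound {pair a b} (x∈p∪q⁺ (inj₁ (x∈⁅x⁆ a))))
                         (⋁-upperBound {pair a b} (x∈p∪q⁺ (inj₂ (x∈⁅x⁆ b))))

  antichain-squeeze : ∀ {C E c e} → Antichain L C → E ≪ C → c ∈ C → e ∈ E → c ≤ e → c ≡ e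
  antichain-squeeze {C} {c = c} acC E≪C c∈C e∈E c≤e with E≪C _ e∈E
  ... | c' , c'∈C , e≤c' with acC c c' c∈C c'∈C (≤-trans c≤e e≤c')
  ... | refl = antisym c≤e e≤c'

  IsMaximalIn : Subset n → Fin n → Set
  IsMaximalIn E e = e ∈ E × (∀ e' → e' ∈ E → e ≤ e' → e ≡ e')

  maximal? : ∀ E → Decidable (IsMaximalIn E)
  maximal? E e = (e ∈? E) ×-dec all? (λ e' → (e' ∈? E) →-dec (e ≤? e') →-dec (e ≟ᶠ e'))

  maximals : Subset n → Subset n
  maximals E = toSubset (maximal? E)

  maximals-⊆ : ∀ E → maximals E ⊆ E
  maximals-⊆ E m∈ = proj₁ (∈-toSubset⁻ (maximal? E) m∈)

  maximals-antichain : ∀ E → Antichain L (maximals E)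
  maximals-antichain E x y x∈ y∈ =
    proj₂ (∈-toSubset⁻ (maximal? E) x∈) y (maximals-⊆ E y∈)

  ↑ : Fin n → Subset n
  ↑ e = toSubset (e ≤?_)

  ↑-strictlyAntitone : ∀ {e e'} → e ≤ e' → e ≢ e' → ↑ e' ⊂ ↑ e
  ↑-strictlyAntitone {e} {e'} e≤e' e≢e' =
    (λ x∈ → ∈-toSubset⁺ (e ≤?_) (≤-trans e≤e' (∈-toSubset⁻ (e' ≤?_) x∈)))
    , e , ∈-toSubset⁺ (e ≤?_) ≤-refl
    , (λ e∈ → e≢e' (antisym e≤e' (∈-toSubset⁻ (e' ≤?_) e∈)))

  below-maximal : ∀ {E e} → Acc (_⊂_ on ↑) e → e ∈ E → ∃ λ m → m ∈ maximals E × e ≤ m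
  below-maximal {E} {e} (acc rec) e∈E
    with any? (λ e' → (e' ∈? E) ×-dec (e ≤? e') ×-dec ¬? (e ≟ᶠ e'))
  ... | yes (e' , e'∈E , e≤e' , e≢e') =
    let (m , m∈ , e'≤m) = below-maximal (rec (↑-strictlyAntitone e≤e' e≢e')) e'∈E
    in m , m∈ , ≤-trans e≤e' e'≤m
  ... | no nothingAbove = e , ∈-toSubset⁺ (maximal? E) (e∈E , maximal) , ≤-refl
    where
    maximal : ∀ e' → e' ∈ E → e ≤ e' → e ≡ e'
    maximal e' e'∈E e≤e' =
      decidable-stable (e ≟ᶠ e') (λ e≢e' → nothingAbove (e' , e'∈E , e≤e' , e≢e'))

  ≪-maximals : ∀ E → E ≪ maximals E
  ≪-maximals E e e∈E = below-maximal (On.wellFounded ↑ ⊂-wellFounded e) e∈E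

  belowSome? : ∀ C → Decidable (λ x → ∃ λ c → c ∈ C × x ≤ c)
  belowSome? C x = any? (λ c → (c ∈? C) ×-dec (x ≤? c))

  ↓ : Subset n → Subset n
  ↓ C = toSubset (belowSome? C)

  ↓-strictlyMonotone : ∀ {C D c} → Antichain L C → D ≪ C → c ∈ C → c ∉ D → ↓ D ⊂ ↓ C
  ↓-strictlyMonotone {C} {D} {c} acC D≪C c∈C c∉D =
    (λ x∈ → let (d , d∈D , x≤d) = ∈-toSubset⁻ (belowSome? D) x∈
                (c' , c'∈C , d≤c') = D≪C d d∈D
            in ∈-toSubset⁺ (belowSome? C) (c' , c'∈C , ≤-trans x≤d d≤c'))
    , c , ∈-toSubset⁺ (belowSome? C) (c , c∈C , ≤-refl) , c∉↓D
    where
    c∉↓D : c ∉ ↓ D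
    c∉↓D c∈ with ∈-toSubset⁻ (belowSome? D) c∈
    ... | d , d∈D , c≤d = c∉D (subst (_∈ D) (sym (antichain-squeeze acC D≪C c∈C d∈D c≤d)) d∈D)

  ProperRefinement : Fin n → Subset n → Subset n → Set
  ProperRefinement a C D = Antichain L D × a ≤ ⋁ L D × D ≪ C × ∃ λ c → c ∈ C × c ∉ D

  properRefinement? : ∀ a C → Decidable (ProperRefinement a C)
  properRefinement? a C D = antichain? D ×-dec (a ≤? ⋁ L D) ×-dec ≪? D C
                            ×-dec any? (λ c → (c ∈? C) ×-dec ¬? (c ∈? D))

  minimalCover-below-antichain : ∀ {a C} → Acc (_⊂_ on ↓) C → Antichain L C → a ≤ ⋁ L C →
                                 ∃ λ D → IsMinJoinCover L a D × D ≪ C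
  minimalCover-below-antichain {a} {C} (acc rec) acC a≤⋁C with anySubset? (properRefinement? a C)
  ... | yes (D , acD , a≤⋁D , D≪C , c , c∈C , c∉D) =
    let (E , E-min , E≪D) = minimalCover-below-antichain
                              (rec {D} (↓-strictlyMonotone acC D≪C c∈C c∉D)) acD a≤⋁D
    in E , E-min , ≪-trans E≪D D≪C
  ... | no noRefinement = C , (acC , a≤⋁C , minimal) , ≪-refl
    where
    minimal : ∀ D → Antichain L D → a ≤ ⋁ L D → D ≪ C → D ≡ C
    minimal D acD a≤⋁D D≪C = ⊆-antisym D⊆C C⊆D
      where
      C⊆D : C ⊆ D
      C⊆D {c} c∈C = decidable-stable (c ∈? D)
        (λ c∉D → noRefinement (D , acD , a≤⋁D , D≪C , c , c∈C , c∉D))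
      D⊆C : D ⊆ C
      D⊆C {d} d∈D =
        let (c , c∈C , d≤c) = D≪C d d∈D
        in subst (_∈ C) (sym (antichain-squeeze acD (⊆⇒≪ C⊆D) d∈D c∈C d≤c)) c∈C

  minimalCover-refining : ∀ {a B} → a ≤ ⋁ L B → ∃ λ D → IsMinJoinCover L a D × D ≪ B
  minimalCover-refining {a} {B} a≤⋁B =
    let (D , D-min , D≪max) = minimalCover-below-antichain
                                (On.wellFounded ↓ ⊂-wellFounded (maximals B))
                                (maximals-antichain B)
                                (≤-trans a≤⋁B (⋁-mono-≪ (≪-maximals B)))
    in D , D-min , ≪-trans D≪max (⊆⇒≪ (maximals-⊆ B))

  minimalCover-⊆ : ∀ {a C E} → IsMinJoinCover L a C → a ≤ ⋁ L E → E ≪ C → C ⊆ E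
  minimalCover-⊆ {E = E} (acC , _ , minimal) a≤⋁E E≪C {c} c∈C =
    let (D , (acD , a≤⋁D , _) , D≪E) = minimalCover-refining a≤⋁E
        D≡C = minimal D acD a≤⋁D (≪-trans D≪E E≪C)
        (e , e∈E , c≤e) = D≪E c (subst (c ∈_) (sym D≡C) c∈C)
    in subst (_∈ E) (sym (antichain-squeeze acC E≪C c∈C e∈E c≤e)) e∈E

  -- Replacing c in C by the elements of F yields a join-cover refining C, which must contain C.
  minimalCover-prime : ∀ {a C c F} → IsMinJoinCover L a C → c ∈ C →
                       c ≤ ⋁ L F → (∀ {f} → f ∈ F → f ≤ c) → c ∈ F
  minimalCover-prime {a} {C} {c} {F} C-min@(_ , a≤⋁C , _) c∈C c≤⋁F F≤c =
    [ (λ (_ , c≢c) → ⊥-elim (c≢c refl)) , (λ c∈F → c∈F) ]′ (∈-toSubset⁻ E? c∈E)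
    where
    E? : Decidable (λ z → (z ∈ C × z ≢ c) ⊎ z ∈ F)
    E? z = ((z ∈? C) ×-dec ¬? (z ≟ᶠ c)) ⊎-dec (z ∈? F)
    E : Subset n
    E = toSubset E?
    C≤⋁E : ∀ {z} → z ∈ C → z ≤ ⋁ L E
    C≤⋁E {z} z∈C with z ≟ᶠ c
    ... | yes refl = ≤-trans c≤⋁F (⋁-mono-⊆ {F} {E} (λ f∈F → ∈-toSubset⁺ E? (inj₂ f∈F)))
    ... | no z≢c = ⋁-upperBound {E} (∈-toSubset⁺ E? (inj₁ (z∈C , z≢c)))
    E≪C : E ≪ C
    E≪C z z∈E with ∈-toSubset⁻ E? z∈E
    ... | inj₁ (z∈C , _) = z , z∈C , ≤-refl
    ... | inj₂ z∈F = c , c∈C , F≤c z∈F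
    c∈E : c ∈ E
    c∈E = minimalCover-⊆ {E = E} C-min (≤-trans a≤⋁C (⋁-least {C} C≤⋁E)) E≪C c∈C

  minimalCover-JI : ∀ {a C c} → IsMinJoinCover L a C → c ∈ C → IsJI L c
  minimalCover-JI {c = c} C-min c∈C = nonBot , split
    where
    nonBot : c ≢ bot
    nonBot refl = ∉⊥ (minimalCover-prime {F = ∅} C-min c∈C (minimum _) (λ f∈∅ → ⊥-elim (∉⊥ f∈∅)))
    split : ∀ x y → c ≡ x ∨ y → c ≡ x ⊎ c ≡ y
    split x y refl = ∈-pair⁻ (minimalCover-prime C-min c∈C (∨≤⋁-pair x y) below)
      where
      below : ∀ {f} → f ∈ pair x y → f ≤ (x ∨ y)
      below f∈ with ∈-pair⁻ f∈
      ... | inj₁ refl = x≤x∨y x y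
      ... | inj₂ refl = y≤x∨y x y

  minimalCover-neighbourhood : ∀ {x D} → IsMinJoinCover L x D → σM L x D
  minimalCover-neighbourhood D-min =
    (λ d d∈D → minimalCover-JI D-min d∈D) , _ , D-min , (λ d∈D → d∈D)

  minimalCover-within : ∀ {x S} → IsDownsetJ L S → x ≤ ⋁ L S →
                        ∃ λ D → IsMinJoinCover L x D × D ⊆ S
  minimalCover-within (S⊆J , S-down) x≤⋁S =
    let (D , D-min , D≪S) = minimalCover-refining x≤⋁S
    in D , D-min , λ {d} d∈D →
         let (s , s∈S , d≤s) = D≪S d d∈D
         in S-down d s (minimalCover-JI D-min d∈D) (S⊆J s s∈S) d≤s s∈S

  closed-∈⇔≤⋁ : ∀ {S} → IsClosedDownset L S → ∀ {x} → IsJI L x → x ∈ S ⇔ x ≤ ⋁ L S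
  closed-∈⇔≤⋁ (S-down , S-closed) x-ji =
    mk⇔ ⋁-upperBound (λ x≤⋁S → from (S-closed _ x-ji) (minimalCover-within S-down x≤⋁S))

  isJI-below? : ∀ a → Decidable (λ x → IsJI L x × x ≤ a)
  isJI-below? a x = isJI? x ×-dec (x ≤? a)

  ↓ᴶ : Fin n → Subset n
  ↓ᴶ a = toSubset (isJI-below? a)

  ↓ᴶ-∈⇔≤ : ∀ {a x} → IsJI L x → x ∈ ↓ᴶ a ⇔ x ≤ a
  ↓ᴶ-∈⇔≤ {a} x-ji = mk⇔ (λ x∈ → proj₂ (∈-toSubset⁻ (isJI-below? a) x∈))
                        (λ x≤a → ∈-toSubset⁺ (isJI-below? a) (x-ji , x≤a))

  ⋁↓ᴶ≤ : ∀ a → ⋁ L (↓ᴶ a) ≤ a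
  ⋁↓ᴶ≤ a = ⋁-least (λ x∈ → proj₂ (∈-toSubset⁻ (isJI-below? a) x∈))

  ≤⋁↓ᴶ : ∀ a → a ≤ ⋁ L (↓ᴶ a)
  ≤⋁↓ᴶ a =
    let (D , D-min@(_ , a≤⋁D , _) , D≪a) = minimalCover-refining (⋁-upperBound (x∈⁅x⁆ a))
        D⊆↓ᴶa : D ⊆ ↓ᴶ a
        D⊆↓ᴶa {d} d∈D =
          let (a' , a'∈ , d≤a') = D≪a d d∈D
          in ∈-toSubset⁺ (isJI-below? a)
               (minimalCover-JI D-min d∈D , subst (d ≤_) (x∈⁅y⁆⇒x≡y a a'∈) d≤a')
    in ≤-trans a≤⋁D (⋁-mono-⊆ D⊆↓ᴶa)

  ≤-fromJI : ∀ {a b} → (∀ {x} → IsJI L x → x ≤ a → x ≤ b) → a ≤ b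
  ≤-fromJI {a} below = ≤-trans (≤⋁↓ᴶ a) (⋁-least λ x∈ →
    let (x-ji , x≤a) = ∈-toSubset⁻ (isJI-below? a) x∈ in below x-ji x≤a)

  ↓ᴶ-closed : ∀ a → IsClosedDownset L (↓ᴶ a)
  ↓ᴶ-closed a = ↓ᴶa-down , λ x x-ji → mk⇔
    (λ x∈ → minimalCover-within ↓ᴶa-down (⋁-upperBound x∈))
    (λ (D , (_ , x≤⋁D , _) , D⊆↓ᴶa) →
      from (↓ᴶ-∈⇔≤ x-ji) (≤-trans x≤⋁D (≤-trans (⋁-mono-⊆ D⊆↓ᴶa) (⋁↓ᴶ≤ a))))
    where
    ↓ᴶa-down : IsDownsetJ L (↓ᴶ a)
    ↓ᴶa-down = (λ x x∈ → proj₁ (∈-toSubset⁻ (isJI-below? a) x∈))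
             , (λ x y x-ji y-ji x≤y y∈ → from (↓ᴶ-∈⇔≤ x-ji) (≤-trans x≤y (to (↓ᴶ-∈⇔≤ y-ji) y∈)))

  Represents : {AtProp : Set} → (AtProp → Subset n) → (AtProp → Fin n) → Set
  Represents u v = ∀ p {x} → IsJI L x → x ∈ u p ⇔ x ≤ v p

  module _ {AtProp : Set} (u : AtProp → Subset n) (v : AtProp → Fin n)
           (u-represents-v : Represents u v) where

    truth : ∀ t {x} → IsJI L x → Forces L u x (ST t) ⇔ x ≤ ⟦_⟧ L t v
    truth ⊥ₜ x-ji = mk⇔ (λ ()) (λ x≤bot → ⊥-elim (proj₁ x-ji (antisym x≤bot (minimum _))))
    truth ⊤ₜ x-ji = mk⇔ (λ _ → maximum _) (λ _ → tt)
    truth (var p) x-ji = u-represents-v p x-ji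
    truth (t ∧ₜ s) x-ji = mk⇔
      (λ (x⊩t , x⊩s) → ∧-greatest (to (truth t x-ji) x⊩t) (to (truth s x-ji) x⊩s))
      (λ x≤t∧s → from (truth t x-ji) (≤-trans x≤t∧s (x∧y≤x _ _))
               , from (truth s x-ji) (≤-trans x≤t∧s (x∧y≤y _ _)))
    truth (t ∨ₜ s) {x} x-ji = mk⇔ forces⇒≤ ≤⇒forces
      where
      tᵛ sᵛ : Fin n
      tᵛ = ⟦_⟧ L t v
      sᵛ = ⟦_⟧ L s v

      forces⇒≤ : Forces L u x (ST (t ∨ₜ s)) → x ≤ (tᵛ ∨ sᵛ)
      forces⇒≤ (C , (C⊆J , D , (_ , x≤⋁D , _) , D⊆C) , C⊩) = ≤-trans x≤⋁D (⋁-least bound)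
        where
        bound : ∀ {d} → d ∈ D → d ≤ (tᵛ ∨ sᵛ)
        bound {d} d∈D with C⊩ d (D⊆C d∈D)
        ... | inj₁ d⊩t = ≤-trans (to (truth t (C⊆J d (D⊆C d∈D))) d⊩t) (x≤x∨y _ _)
        ... | inj₂ d⊩s = ≤-trans (to (truth s (C⊆J d (D⊆C d∈D))) d⊩s) (y≤x∨y _ _)

      ≤⇒forces : x ≤ (tᵛ ∨ sᵛ) → Forces L u x (ST (t ∨ₜ s))
      ≤⇒forces x≤t∨s with minimalCover-refining (≤-trans x≤t∨s (∨≤⋁-pair tᵛ sᵛ))
      ... | D , D-min , D≪ts = D , minimalCover-neighbourhood D-min , forcesEach
        where
        forcesEach : ∀ d → d ∈ D → Forces L u d (ST t) ⊎ Forces L u d (ST s)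
        forcesEach d d∈D with D≪ts d d∈D
        ... | b , b∈ , d≤b with ∈-pair⁻ {tᵛ} {sᵛ} b∈
        ... | inj₁ refl = inj₁ (from (truth t (minimalCover-JI D-min d∈D)) d≤b)
        ... | inj₂ refl = inj₂ (from (truth s (minimalCover-JI D-min d∈D)) d≤b)

  valid⇒frameValid : ∀ {AtProp} (t s : Term AtProp) → Valid≤ L t s → FrameValid≤ L (ST t) (ST s)
  valid⇒frameValid {AtProp} t s t≤s u u-closed j j-ji j⊩t =
    from (truth u v u-represents-v s j-ji)
         (≤-trans (to (truth u v u-represents-v t j-ji) j⊩t) (t≤s v))
    where
    v : AtProp → Fin n
    v p = ⋁ L (u p)
    u-represents-v : Represents u v
    u-represents-v p = closed-∈⇔≤⋁ (u-closed p)

  frameValid⇒valid : ∀ {AtProp} (t s : Term AtProp) → FrameValid≤ L (ST t) (ST s) → Valid≤ L t s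
  frameValid⇒valid {AtProp} t s t⊩s v = ≤-fromJI λ x-ji x≤t →
    to (truth u v u-represents-v s x-ji)
       (t⊩s u (λ p → ↓ᴶ-closed (v p)) _ x-ji (from (truth u v u-represents-v t x-ji) x≤t))
    where
    u : AtProp → Subset n
    u p = ↓ᴶ (v p)
    u-represents-v : Represents u v
    u-represents-v p = ↓ᴶ-∈⇔≤

mainTheorem4 : (L : FiniteLattice) (AtProp : Set) (t s : Term AtProp) →
    Valid≤ L t s ⇔ FrameValid≤ L (ST t) (ST s)
mainTheorem4 L AtProp t s = mk⇔ (valid⇒frameValid L t s) (frameValid⇒valid L t s)
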